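{- Fix $\varepsilon>0$. Let $G_t$ be obtained from the complete signed graph $G_{t-1}$ by flipping the sign of the pair $e=\{u,v\}$, and let $S=N_{G^+_{t-1}}(u)\cup N_{G^+_{t-1}}(v)\cup\{u,v\}$. Let $w\notin S$ and let $f=\{x,w\}$ be an edge of positive sign. If $f$ is present in exactly one of the sparsified graphs $\widetilde{G^+_{t-1}}$ and $\widetilde{G^+_t}$, then $w$ is $\varepsilon$-light in $G^+_{t-1}$, $x\in S$, and $w$ and $x$ are in $\varepsilon$-agreement (in $G^+_{t-1}$).
   Context: A complete signed graph on a finite vertex set $V$ assigns to every unordered pair of distinct vertices a sign $+$ or $-$. For such a graph $X$, its positive graph $X^+$ has vertex set $V$ and as edges the pairs of sign $+$; $N_{X^+}(a)$ is the open neighborhood of $a$ in $X^+$. $\mathrm{NonAgreement}_{X^+}(a,b)=\frac{|N_{X^+}(a)\,\Delta\,N_{X^+}(b)|}{\max\{|N_{X^+}(a)|,|N_{X^+}(b)|\}}$. Vertices $a,b$ are in $\varepsilon$-agreement in $X^+$ if $\{a,b\}$ is an edge of $X^+$ and $\mathrm{NonAgreement}_{X^+}(a,b)<\varepsilon$. $\mathrm{AgreeCnt}_{X^+}(a)$ is the number of vertices in $\varepsilon$-agreement with $a$; $a$ is $\varepsilon$-light if $\mathrm{AgreeCnt}_{X^+}(a)/|N_{X^+}(a)|<\varepsilon$. The sparsified graph $\widetilde{X^+}$ is obtained from $X^+$ by deleting every edge whose endpoints are not in $\varepsilon$-agreement and every edge whose two endpoints are both $\varepsilon$-light. -}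

module Defs where

open import Data.Nat as ℕ using (ℕ; zero; suc; _⊔_)
open import Data.Integer using (+_)
open import Data.Rational using (ℚ; _/_; _<_; 0ℚ)
open import Data.Rational.Properties using (_<?_)
open import Data.Bool using (Bool; true; false; not; _∧_; _∨_; if_then_else_; T)
open import Data.Fin using (Fin; _≟_)
open import Data.Fin.Subset using (Subset; _∪_; _─_; ∣_∣)
open import Data.Vec using (tabulate)
open import Data.Product using (_×_)
open import Data.Sum using (_⊎_)
open import Relation.Nullary using (¬_; does)
open import Relation.Binary.PropositionalEquality using (_≡_)

-- A complete signed graph on vertex set Fin n: a sign (true = +, false = -)
-- for every ordered pair; only off-diagonal values matter, and the graph is
-- required to be symmetric (unordered pairs) via `SymmetricSign`.
Sign : ℕ → Set
Sign n = Fin n → Fin n → Bool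

SymmetricSign : ∀ {n} → Sign n → Set
SymmetricSign σ = ∀ a b → σ a b ≡ σ b a

_==_ : ∀ {n} → Fin n → Fin n → Bool
a == b = does (a ≟ b)

flipPair : ∀ {n} → Sign n → Fin n → Fin n → Sign n
flipPair σ u v a b =
  if ((a == u) ∧ (b == v)) ∨ ((a == v) ∧ (b == u)) then not (σ a b) else σ a b

posB : ∀ {n} → Sign n → Fin n → Fin n → Bool
posB σ a b = not (a == b) ∧ σ a b

Pos : ∀ {n} → Sign n → Fin n → Fin n → Set
Pos σ a b = T (posB σ a b)

N : ∀ {n} → Sign n → Fin n → Subset n
N σ a = tabulate (posB σ a)

deg : ∀ {n} → Sign n → Fin n → ℕ
deg σ a = ∣ N σ a ∣

-- ratio k / d as a rational; convention: 0 when d = 0 (0/0 is undefined in the paper,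
-- and it never arises in the relevant situations)
ratio : ℕ → ℕ → ℚ
ratio k zero    = 0ℚ
ratio k (suc d) = (+ k) / suc d

NonAgreement : ∀ {n} → Sign n → Fin n → Fin n → ℚ
NonAgreement σ a b =
  ratio ∣ (N σ a ─ N σ b) ∪ (N σ b ─ N σ a) ∣ (deg σ a ⊔ deg σ b)

module _ (ε : ℚ) where

  agreeB : ∀ {n} → Sign n → Fin n → Fin n → Bool
  agreeB σ a b = posB σ a b ∧ does (NonAgreement σ a b <? ε)

  InAgreement : ∀ {n} → Sign n → Fin n → Fin n → Set
  InAgreement σ a b = Pos σ a b × NonAgreement σ a b < ε

  AgreeCnt : ∀ {n} → Sign n → Fin n → ℕ
  AgreeCnt σ a = ∣ tabulate (agreeB σ a) ∣

  Light : ∀ {n} → Sign n → Fin n → Set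
  Light σ a = ratio (AgreeCnt σ a) (deg σ a) < ε

  SparseEdge : ∀ {n} → Sign n → Fin n → Fin n → Set
  SparseEdge σ a b = InAgreement σ a b × ¬ (Light σ a × Light σ b)

InS : ∀ {n} → Sign n → Fin n → Fin n → Fin n → Set
InS σ u v y = Pos σ u y ⊎ Pos σ v y ⊎ y ≡ u ⊎ y ≡ v

{-# OPTIONS --safe #-}
module Submission where

-- Every quantity entering "{x,w} is an edge of the sparsified graph" is read off
-- the signs in the rows of x, of w, and of their positive neighbours.  Flipping
-- {u,v} changes only the rows of u and v, so the rows of a vertex outside S and
-- of all its neighbours are untouched.  Hence flipping cannot affect whether w
-- and x agree, nor whether w is light, and if x were outside S it could not
-- affect whether x is light either.  Since the sparse status of {x,w} does
-- change, x and w agree, w is light (otherwise the edge survives in both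
-- graphs) and x lies in S.

open import Defs
open import Data.Bool using (true; false; not; _∧_; T)
open import Data.Fin using (Fin; _≟_)
open import Data.Fin.Subset using (_∪_; _─_; ∣_∣)
open import Data.Fin.Subset.Properties using (∪-comm)
open import Data.Nat using (ℕ; _⊔_)
open import Data.Nat.Properties using (⊔-comm)
open import Data.Product using (_×_; _,_; proj₁; proj₂)
open import Data.Rational using (ℚ; _<_; 0ℚ)
open import Data.Rational.Properties using (_<?_)
open import Data.Sum using (_⊎_; inj₁; inj₂; [_,_]′)
open import Data.Vec.Properties using (tabulate-cong)
open import Function using (id; _∘_)
open import Relation.Nullary using (¬_; Dec; yes; no; does; contradiction)
open import Relation.Nullary.Decidable using (_⊎-dec_; T?; decidable-stable)
open import Relation.Binary.PropositionalEquality

private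
  variable
    n : ℕ
    σ τ : Sign n
    a b u v : Fin n

exactly-one-⇒-≢ : ∀ {A B : Set} → (A × ¬ B) ⊎ (¬ A × B) → A ≢ B
exactly-one-⇒-≢ (inj₁ (a , ¬b)) refl = ¬b a
exactly-one-⇒-≢ (inj₂ (¬a , b)) refl = ¬a b

exactly-one-⇒-¬both : ∀ {A B : Set} → (A × ¬ B) ⊎ (¬ A × B) → ¬ (A × B)
exactly-one-⇒-¬both (inj₁ (_ , ¬b)) (_ , b) = ¬b b
exactly-one-⇒-¬both (inj₂ (¬a , _)) (a , _) = ¬a a

==-sym : (a b : Fin n) → (a == b) ≡ (b == a)
==-sym a b with a ≟ b | b ≟ a
... | yes _ | yes _   = refl
... | no _  | no _    = refl
... | yes p | no ¬q   = contradiction (sym p) ¬q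
... | no ¬p | yes q   = contradiction (sym q) ¬p

Pos-sym : SymmetricSign σ → Pos σ a b → Pos σ b a
Pos-sym {σ = σ} {a} {b} σ-sym =
  subst T (cong₂ (λ eq s → not eq ∧ s) (==-sym a b) (σ-sym a b))

NonAgreement-sym : (σ : Sign n) (a b : Fin n) → NonAgreement σ a b ≡ NonAgreement σ b a
NonAgreement-sym σ a b =
  cong₂ ratio (cong ∣_∣ (∪-comm (N σ a ─ N σ b) (N σ b ─ N σ a)))
              (⊔-comm (deg σ a) (deg σ b))

InAgreement-sym : ∀ ε → SymmetricSign σ → InAgreement ε σ a b → InAgreement ε σ b a
InAgreement-sym {σ = σ} {a} {b} ε σ-sym (ab , na<ε) =
  Pos-sym σ-sym ab , subst (_< ε) (NonAgreement-sym σ a b) na<ε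

record SameRow (σ τ : Sign n) (a : Fin n) : Set where
  constructor sameRow
  field same-row : σ a ≗ τ a
open SameRow

SameRowsAround : Sign n → Sign n → Fin n → Set
SameRowsAround σ τ a = SameRow σ τ a × (∀ b → Pos σ a b → SameRow σ τ b)

flipPair-SameRow : (σ : Sign n) → a ≢ u → a ≢ v → SameRow σ (flipPair σ u v) a
flipPair-SameRow {a = a} {u} {v} σ a≢u a≢v = sameRow λ b → unflipped b
  where
  unflipped : σ a ≗ flipPair σ u v a
  unflipped b with a ≟ u | a ≟ v
  ... | yes a≡u | _       = contradiction a≡u a≢u
  ... | no _    | yes a≡v = contradiction a≡v a≢v
  ... | no _    | no _    = refl

neighbour-of-outsideS-SameRow : SymmetricSign σ → ¬ InS σ u v a → Pos σ a b →
                                SameRow σ (flipPair σ u v) b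
neighbour-of-outsideS-SameRow {σ = σ} σ-sym a∉S ab =
  flipPair-SameRow σ (λ { refl → a∉S (inj₁ (Pos-sym σ-sym ab)) })
                     (λ { refl → a∉S (inj₂ (inj₁ (Pos-sym σ-sym ab))) })

outsideS-SameRowsAround : SymmetricSign σ → ¬ InS σ u v a →
                          SameRowsAround σ (flipPair σ u v) a
outsideS-SameRowsAround {σ = σ} σ-sym a∉S =
  flipPair-SameRow σ (λ a≡u → a∉S (inj₂ (inj₂ (inj₁ a≡u))))
                     (λ a≡v → a∉S (inj₂ (inj₂ (inj₂ a≡v)))) ,
  λ _ → neighbour-of-outsideS-SameRow σ-sym a∉S

posB-cong : SameRow σ τ a → posB σ a ≗ posB τ a
posB-cong {a = a} same b = cong (not (a == b) ∧_) (same-row same b)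

N-cong : SameRow σ τ a → N σ a ≡ N τ a
N-cong same = tabulate-cong (posB-cong same)

NonAgreement-cong : SameRow σ τ a → SameRow σ τ b →
                    NonAgreement σ a b ≡ NonAgreement τ a b
NonAgreement-cong sameᵃ sameᵇ =
  cong₂ (λ A B → ratio ∣ (A ─ B) ∪ (B ─ A) ∣ (∣ A ∣ ⊔ ∣ B ∣)) (N-cong sameᵃ) (N-cong sameᵇ)

module _ (ε : ℚ) where

  InAgreement-cong : SameRow σ τ a → SameRow σ τ b →
                     InAgreement ε σ a b ≡ InAgreement ε τ a b
  InAgreement-cong sameᵃ sameᵇ =
    cong₂ (λ p q → T p × q < ε) (posB-cong sameᵃ _) (NonAgreement-cong sameᵃ sameᵇ)

  agreeB-cong : SameRowsAround σ τ a → agreeB ε σ a ≗ agreeB ε τ a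
  agreeB-cong {σ = σ} {τ} {a} (sameᵃ , sameᴺ) b with posB σ a b in ab
  ... | false = cong (_∧ does (NonAgreement τ a b <? ε)) (trans (sym ab) (posB-cong sameᵃ b))
  ... | true  = cong₂ _∧_ (trans (sym ab) (posB-cong sameᵃ b))
                          (cong (λ q → does (q <? ε))
                                (NonAgreement-cong sameᵃ (sameᴺ b (subst T (sym ab) _))))

  Light-cong : SameRowsAround σ τ a → Light ε σ a ≡ Light ε τ a
  Light-cong around =
    cong₂ (λ k d → ratio k d < ε)
          (cong ∣_∣ (tabulate-cong (agreeB-cong around)))
          (cong ∣_∣ (N-cong (proj₁ around)))

  SparseEdge-cong : SameRowsAround σ τ a → SameRowsAround σ τ b →
                    SparseEdge ε σ a b ≡ SparseEdge ε τ a b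
  SparseEdge-cong aroundᵃ aroundᵇ =
    cong₂ (λ A L → A × ¬ L)
          (InAgreement-cong (proj₁ aroundᵃ) (proj₁ aroundᵇ))
          (cong₂ _×_ (Light-cong aroundᵃ) (Light-cong aroundᵇ))

  InAgreement-¬Light⇒SparseEdge : InAgreement ε σ a b → ¬ Light ε σ b → SparseEdge ε σ a b
  InAgreement-¬Light⇒SparseEdge agree b-heavy = agree , b-heavy ∘ proj₂

InS? : (σ : Sign n) (u v y : Fin n) → Dec (InS σ u v y)
InS? σ u v y = T? (posB σ u y) ⊎-dec (T? (posB σ v y) ⊎-dec ((y ≟ u) ⊎-dec (y ≟ v)))

lemma3 : ∀ {n} (ε : ℚ) → 0ℚ < ε →
         (σ : Sign n) → SymmetricSign σ →
         (u v : Fin n) → u ≢ v →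
         (w x : Fin n) → ¬ InS σ u v w → Pos σ x w →
         ((SparseEdge ε σ x w × ¬ SparseEdge ε (flipPair σ u v) x w)
           ⊎ (¬ SparseEdge ε σ x w × SparseEdge ε (flipPair σ u v) x w)) →
         Light ε σ w × InS σ u v x × InAgreement ε σ w x
lemma3 ε _ σ σ-sym u v _ w x w∉S xw exactly-one =
  w-light , x∈S , InAgreement-sym ε σ-sym agree
  where
  around-w : SameRowsAround σ (flipPair σ u v) w
  around-w = outsideS-SameRowsAround σ-sym w∉S

  agree-cong : InAgreement ε σ x w ≡ InAgreement ε (flipPair σ u v) x w
  agree-cong = InAgreement-cong ε (neighbour-of-outsideS-SameRow σ-sym w∉S (Pos-sym σ-sym xw))
                                  (proj₁ around-w)

  agree : InAgreement ε σ x w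
  agree = [ (λ sparse → proj₁ (proj₁ sparse))
          , (λ sparse → subst id (sym agree-cong) (proj₁ (proj₂ sparse))) ]′ exactly-one

  w-light : Light ε σ w
  w-light = decidable-stable (_ <? ε) λ w-heavy →
    exactly-one-⇒-¬both exactly-one
      ( InAgreement-¬Light⇒SparseEdge ε {σ = σ} {x} {w} agree w-heavy
      , InAgreement-¬Light⇒SparseEdge ε {σ = flipPair σ u v} {x} {w}
                                        (subst id agree-cong agree)
                                        (w-heavy ∘ subst id (sym (Light-cong ε around-w))) )

  x∈S : InS σ u v x
  x∈S = decidable-stable (InS? σ u v x) λ x∉S →
    exactly-one-⇒-≢ exactly-one
      (SparseEdge-cong ε (outsideS-SameRowsAround σ-sym x∉S) around-w)
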